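{- For every graph $\mathcal{G}$, $\lceil 2\sqrt{\theta_1(\mathcal{G})}\,\rceil\le\theta^{c}(\mathcal{G})\le 1+\theta_1(\mathcal{G})$.
   Context: Graphs are finite, simple and undirected. For a graph $\mathcal{G}=(\mathcal{V},\mathcal{E})$ and positive integers $\alpha,\beta$, an $(\alpha\mid\beta)$-cointersection representation (CIR) of $\mathcal{G}$ consists of two disjoint finite sets of features $\mathcal{A},\mathcal{B}$ with $|\mathcal{A}|=\alpha$, $|\mathcal{B}|=\beta$, together with an assignment to each vertex $v$ of subsets $A_v\subseteq\mathcal{A}$, $B_v\subseteq\mathcal{B}$ (possibly empty), such that for all distinct $u,v\in\mathcal{V}$: $(u,v)\in\mathcal{E}$ if and only if $A_u\cap A_v\neq\varnothing$ and $B_u\cap B_v\neq\varnothing$. The cointersection number $\theta^{c}(\mathcal{G})$ is the minimum of $\alpha+\beta$ over all CIRs of $\mathcal{G}$. The intersection number $\theta_1(\mathcal{G})$ is the minimum size of a nonempty finite set $F$ for which there exist subsets $S_v\subseteq F$ (possibly empty) such that distinct $u,v$ are adjacent iff $S_u\cap S_v\ne\varnothing$; for a graph with at least one edge this equals the minimum number of cliques needed to cover all edges, and for an edgeless graph it equals $1$. -}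

module Defs where

open import Data.Nat using (ℕ; _+_; _*_; _≤_)
open import Data.Fin using (Fin)
open import Data.Bool using (Bool; true; false)
open import Data.Product using (∃; _×_; Σ)
open import Relation.Binary.PropositionalEquality using (_≡_; _≢_)
open import Relation.Nullary using (¬_)

record Graph : Set where
  field
    n     : ℕ
    adj   : Fin n → Fin n → Bool
    sym   : ∀ u v → adj u v ≡ adj v u
    irrefl : ∀ v → adj v v ≡ false

open Graph public

Adj : (G : Graph) → Fin (n G) → Fin (n G) → Set
Adj G u v = adj G u v ≡ true

FSub : ℕ → Set
FSub m = Fin m → Bool

Meet : {m : ℕ} → FSub m → FSub m → Set
Meet {m} S T = ∃ λ (a : Fin m) → (S a ≡ true) × (T a ≡ true)

record CIR (G : Graph) (α β : ℕ) : Set where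
  field
    A : Fin (n G) → FSub α
    B : Fin (n G) → FSub β
    correct : ∀ u v → u ≢ v → (Adj G u v → Meet (A u) (A v) × Meet (B u) (B v))
                               × (Meet (A u) (A v) × Meet (B u) (B v) → Adj G u v)

record IR (G : Graph) (m : ℕ) : Set where
  field
    S : Fin (n G) → FSub m
    correct : ∀ u v → u ≢ v → (Adj G u v → Meet (S u) (S v))
                               × (Meet (S u) (S v) → Adj G u v)

IsCointersectionNumber : Graph → ℕ → Set
IsCointersectionNumber G k =
  (Σ ℕ λ α → Σ ℕ λ β → (1 ≤ α) × (1 ≤ β) × CIR G α β × (α + β ≡ k))
  × (∀ α β → 1 ≤ α → 1 ≤ β → CIR G α β → k ≤ α + β)

IsIntersectionNumber : Graph → ℕ → Set
IsIntersectionNumber G t =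
  (1 ≤ t) × IR G t × (∀ m → 1 ≤ m → IR G m → t ≤ m)

-- c = ⌈ 2 √t ⌉, i.e. c is the least natural number with 2√t ≤ c,
-- equivalently the least c with 4t ≤ c².
IsCeilTwoSqrt : ℕ → ℕ → Set
IsCeilTwoSqrt t c = (4 * t ≤ c * c) × (∀ m → 4 * t ≤ m * m → c ≤ m)

module Submission where

-- Upper bound: an intersection representation S with t features yields a
-- (t | 1)-cointersection representation by taking A_v = S_v and giving every
-- vertex the single B-feature; hence θ^c ≤ t + 1.
--
-- Lower bound: an (α | β)-CIR yields an intersection representation on the
-- product feature set A × B (identified with Fin (α * β)) via S_v = A_v × B_v,
-- since two products meet iff both pairs of factors meet.  So θ₁ ≤ α β, and
-- AM-GM, 4 α β ≤ (α + β)², gives 4 θ₁ ≤ (θ^c)²; minimality of ⌈2√θ₁⌉ then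
-- yields ⌈2√θ₁⌉ ≤ θ^c.

open import Defs
open import Data.Nat using (ℕ; _+_; _*_; _≤_; _∸_)
open import Data.Nat.Properties
  using (≤-total; ≤-refl; ≤-trans; m≤m+n; m+[n∸m]≡n; +-comm; *-comm; *-mono-≤; *-monoʳ-≤)
open import Data.Nat.Tactic.RingSolver using (solve-∀)
open import Data.Fin using (Fin; zero; combine; remQuot)
open import Data.Fin.Properties using (remQuot-combine)
open import Data.Bool using (Bool; true; _∧_)
open import Data.Sum using (inj₁; inj₂)
open import Data.Product using (_×_; _,_; proj₁; proj₂)
open import Relation.Binary.PropositionalEquality using (_≡_; refl; subst; subst₂)
  renaming (sym to ≡-sym)

-- AM-GM over ℕ in squared form.  For a ≤ b write b = a + d; then
-- (2a + d)² = 4a(a + d) + d².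
square-of-sum : ∀ a d → (a + (a + d)) * (a + (a + d)) ≡ 4 * (a * (a + d)) + d * d
square-of-sum = solve-∀

am-gm-ordered : ∀ a b → a ≤ b → 4 * (a * b) ≤ (a + b) * (a + b)
am-gm-ordered a b a≤b =
  subst (λ b → 4 * (a * b) ≤ (a + b) * (a + b)) (m+[n∸m]≡n a≤b)
    (subst (4 * (a * (a + d)) ≤_) (≡-sym (square-of-sum a d)) (m≤m+n _ (d * d)))
  where d = b ∸ a

am-gm : ∀ a b → 4 * (a * b) ≤ (a + b) * (a + b)
am-gm a b with ≤-total a b
... | inj₁ a≤b = am-gm-ordered a b a≤b
... | inj₂ b≤a = subst₂ (λ x y → 4 * x ≤ y * y) (*-comm b a) (+-comm b a) (am-gm-ordered b a b≤a)

∧-intro : {x y : Bool} → x ≡ true → y ≡ true → x ∧ y ≡ true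
∧-intro refl refl = refl

∧-elim : {x y : Bool} → x ∧ y ≡ true → (x ≡ true) × (y ≡ true)
∧-elim {true} {true} _ = refl , refl

-- The product S × T of feature subsets, as a subset of Fin (α * β), where a
-- feature i stands for the pair remQuot i (inverse to combine).
_⊗_ : {α β : ℕ} → FSub α → FSub β → FSub (α * β)
_⊗_ {α} {β} S T i = S (proj₁ (remQuot {α} β i)) ∧ T (proj₂ (remQuot {α} β i))

⊗-intro : {α β : ℕ} (S : FSub α) (T : FSub β) {a : Fin α} {b : Fin β} →
          S a ≡ true → T b ≡ true → (S ⊗ T) (combine a b) ≡ true
⊗-intro {α} {β} S T {a} {b} Sa Tb =
  subst (λ p → S (proj₁ p) ∧ T (proj₂ p) ≡ true) (≡-sym (remQuot-combine {α} {β} a b))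
        (∧-intro Sa Tb)

⊗-meet : {α β : ℕ} (S S' : FSub α) (T T' : FSub β) →
         Meet S S' × Meet T T' → Meet (S ⊗ T) (S' ⊗ T')
⊗-meet S S' T T' ((a , Sa , S'a) , (b , Tb , T'b)) =
  combine a b , ⊗-intro S T Sa Tb , ⊗-intro S' T' S'a T'b

⊗-meet⁻¹ : {α β : ℕ} (S S' : FSub α) (T T' : FSub β) →
           Meet (S ⊗ T) (S' ⊗ T') → Meet S S' × Meet T T'
⊗-meet⁻¹ {α} {β} S S' T T' (i , inST , inS'T') =
  (a , proj₁ STab , proj₁ S'T'ab) , (b , proj₂ STab , proj₂ S'T'ab)
  where
  a = proj₁ (remQuot {α} β i)
  b = proj₂ (remQuot {α} β i)
  STab : (S a ≡ true) × (T b ≡ true)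
  STab = ∧-elim inST
  S'T'ab : (S' a ≡ true) × (T' b ≡ true)
  S'T'ab = ∧-elim inS'T'

cir→ir : (G : Graph) {α β : ℕ} → CIR G α β → IR G (α * β)
cir→ir G R = record
  { S       = λ v → A v ⊗ B v
  ; correct = λ u v u≢v →
      (λ uv → ⊗-meet (A u) (A v) (B u) (B v) (proj₁ (correct u v u≢v) uv))
    , (λ m → proj₂ (correct u v u≢v) (⊗-meet⁻¹ (A u) (A v) (B u) (B v) m))
  }
  where open CIR R

ir→cir : (G : Graph) {m : ℕ} → IR G m → CIR G m 1
ir→cir G r = record
  { A       = S
  ; B       = λ _ _ → true
  ; correct = λ u v u≢v →
      (λ uv → proj₁ (correct u v u≢v) uv , (zero , refl , refl))
    , (λ m → proj₂ (correct u v u≢v) (proj₁ m))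
  }
  where open IR r

corollary1 : (G : Graph) (t k c : ℕ) → IsIntersectionNumber G t → IsCointersectionNumber G k → IsCeilTwoSqrt t c → (c ≤ k) × (k ≤ 1 + t)
corollary1 G t k c (1≤t , ir , t-min) ((α , β , 1≤α , 1≤β , R , α+β≡k) , k-min) (_ , c-min) =
  c-min k 4t≤k² , k≤1+t
  where
  t≤αβ : t ≤ α * β
  t≤αβ = t-min (α * β) (*-mono-≤ 1≤α 1≤β) (cir→ir G R)
  4t≤k² : 4 * t ≤ k * k
  4t≤k² = ≤-trans (*-monoʳ-≤ 4 t≤αβ)
                  (subst (λ s → 4 * (α * β) ≤ s * s) α+β≡k (am-gm α β))
  k≤1+t : k ≤ 1 + t
  k≤1+t = subst (k ≤_) (+-comm t 1) (k-min t 1 1≤t ≤-refl (ir→cir G ir))
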